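{- There is an explosive extension of $\mathsf{ETL}$ which is not finitary.
   Context: Formulas are built from a countably infinite set of variables using $\wedge,\vee$, ${\sim}$, $\top,\bot$. A logic is a set of rules $\Gamma\vdash\varphi$ ($\Gamma$ a possibly infinite set of formulas) closed under reflexivity, monotonicity, cut and substitution; it is finitary if $\Gamma\vdash\varphi$ implies $\Gamma'\vdash\varphi$ for some finite $\Gamma'\subseteq\Gamma$. $\mathsf{ETL}$ is the set of rules valid in $\langle\mathbf{DM}_4,\{\top\}\rangle$, where $\mathbf{DM}_4$ is the De Morgan algebra on $\{\bot,n,b,\top\}$ with $\bot<n,b<\top$ ($n,b$ incomparable), ${\sim}$ swapping $\top,\bot$ and fixing $n,b$ (a rule being valid if every valuation sending the premises to $\top$ sends the conclusion to $\top$). An explosive rule is a rule $\Gamma\vdash p$ where $p$ does not occur in $\Gamma$, or more generally a rule $\sigma[\Gamma]\vdash p$ for an injective renaming $\sigma$ of variables avoiding $p$; an explosive extension of $\mathsf{ETL}$ is the least logic containing $\mathsf{ETL}$ and a set of explosive rules. -}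

module Defs where

open import Level using (Level; _⊔_) renaming (suc to lsuc; zero to lzero)
open import Data.Nat using (ℕ)
open import Data.Product using (Σ; Σ-syntax; ∃; _×_; _,_)
open import Data.Sum using (_⊎_)
open import Data.List using (List)
open import Data.List.Relation.Unary.All using (All)
open import Data.List.Membership.Propositional using (_∈_)
open import Relation.Binary.PropositionalEquality using (_≡_; _≢_)
open import Relation.Nullary using (¬_)
open import Function.Definitions using (Injective)

data Fm : Set where
  var  : ℕ → Fm
  _∧_  : Fm → Fm → Fm
  _∨_  : Fm → Fm → Fm
  ∼_   : Fm → Fm
  ⊤f   : Fm
  ⊥f   : Fm

subst : (ℕ → Fm) → Fm → Fm
subst s (var n) = s n
subst s (φ ∧ ψ) = subst s φ ∧ subst s ψ
subst s (φ ∨ ψ) = subst s φ ∨ subst s ψ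
subst s (∼ φ)   = ∼ subst s φ
subst s ⊤f      = ⊤f
subst s ⊥f      = ⊥f

rename : (ℕ → ℕ) → Fm → Fm
rename σ = subst (λ n → var (σ n))

FmSet : Set₁
FmSet = Fm → Set

_⊆_ : FmSet → FmSet → Set
Γ ⊆ Δ = ∀ ψ → Γ ψ → Δ ψ

_∪_ : FmSet → FmSet → FmSet
(Γ ∪ Δ) ψ = Γ ψ ⊎ Δ ψ

_[_] : (ℕ → Fm) → FmSet → FmSet
(s [ Γ ]) ψ = Σ[ χ ∈ Fm ] (Γ χ × ψ ≡ subst s χ)

⟦_⟧ : List Fm → FmSet
⟦ xs ⟧ ψ = ψ ∈ xs

RuleSet : (ℓ : Level) → Set (lsuc ℓ)
RuleSet ℓ = FmSet → Fm → Set ℓ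

record IsLogic (L : RuleSet lzero) : Set₁ where
  field
    reflexivity  : ∀ Γ φ → Γ φ → L Γ φ
    monotonicity : ∀ Γ Δ φ → Γ ⊆ Δ → L Γ φ → L Δ φ
    cut          : ∀ Γ Δ φ → (∀ ψ → Δ ψ → L Γ ψ) → L (Γ ∪ Δ) φ → L Γ φ
    substitution : ∀ Γ φ (s : ℕ → Fm) → L Γ φ → L (s [ Γ ]) (subst s φ)

Finitary : ∀ {ℓ} → RuleSet ℓ → Set (lsuc lzero ⊔ ℓ)
Finitary L = ∀ Γ φ → L Γ φ →
  Σ[ Γ' ∈ List Fm ] (All Γ Γ' × L ⟦ Γ' ⟧ φ)

data DM4 : Set where
  ⊥₄ n₄ b₄ ⊤₄ : DM4

_⊓_ : DM4 → DM4 → DM4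
⊥₄ ⊓ y  = ⊥₄
⊤₄ ⊓ y  = y
n₄ ⊓ ⊥₄ = ⊥₄
n₄ ⊓ n₄ = n₄
n₄ ⊓ b₄ = ⊥₄
n₄ ⊓ ⊤₄ = n₄
b₄ ⊓ ⊥₄ = ⊥₄
b₄ ⊓ n₄ = ⊥₄
b₄ ⊓ b₄ = b₄
b₄ ⊓ ⊤₄ = b₄

_⊔₄_ : DM4 → DM4 → DM4
⊤₄ ⊔₄ y  = ⊤₄
⊥₄ ⊔₄ y  = y
n₄ ⊔₄ ⊥₄ = n₄
n₄ ⊔₄ n₄ = n₄
n₄ ⊔₄ b₄ = ⊤₄
n₄ ⊔₄ ⊤₄ = ⊤₄
b₄ ⊔₄ ⊥₄ = b₄
b₄ ⊔₄ n₄ = ⊤₄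
b₄ ⊔₄ b₄ = b₄
b₄ ⊔₄ ⊤₄ = ⊤₄

neg₄ : DM4 → DM4
neg₄ ⊥₄ = ⊤₄
neg₄ n₄ = n₄
neg₄ b₄ = b₄
neg₄ ⊤₄ = ⊥₄

eval : (ℕ → DM4) → Fm → DM4
eval v (var n) = v n
eval v (φ ∧ ψ) = eval v φ ⊓ eval v ψ
eval v (φ ∨ ψ) = eval v φ ⊔₄ eval v ψ
eval v (∼ φ)   = neg₄ (eval v φ)
eval v ⊤f      = ⊤₄
eval v ⊥f      = ⊥₄

ETL : RuleSet lzero
ETL Γ φ = ∀ (v : ℕ → DM4) → (∀ ψ → Γ ψ → eval v ψ ≡ ⊤₄) → eval v φ ≡ ⊤₄

data Occurs (p : ℕ) : Fm → Set where
  here : Occurs p (var p)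
  ∧ˡ : ∀ {φ ψ} → Occurs p φ → Occurs p (φ ∧ ψ)
  ∧ʳ : ∀ {φ ψ} → Occurs p ψ → Occurs p (φ ∧ ψ)
  ∨ˡ : ∀ {φ ψ} → Occurs p φ → Occurs p (φ ∨ ψ)
  ∨ʳ : ∀ {φ ψ} → Occurs p ψ → Occurs p (φ ∨ ψ)
  ∼∙ : ∀ {φ} → Occurs p φ → Occurs p (∼ φ)

-- Explosive rules: σ[Γ] ⊢ p with σ an injective renaming such that p
-- does not occur in σ[Γ] (σ = identity gives the basic form Γ ⊢ p with
-- p not occurring in Γ)

record Explosive : Set₁ where
  field
    prem   : FmSet
    σ      : ℕ → ℕ
    σ-inj  : Injective _≡_ _≡_ σ
    p      : ℕ
    avoids : ∀ ψ → prem ψ → ¬ Occurs p (rename σ ψ)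

explPrem : Explosive → FmSet
explPrem r = (λ n → var (Explosive.σ r n)) [ Explosive.prem r ]

explConc : Explosive → Fm
explConc r = var (Explosive.p r)

-- the least logic containing ETL and the explosive rules R i (i : I):
-- the intersection of all logics containing them
ExplExt : {I : Set} → (I → Explosive) → RuleSet (lsuc lzero)
ExplExt {I} R Γ φ =
  ∀ (L : RuleSet lzero) → IsLogic L →
    (∀ Δ ψ → ETL Δ ψ → L Δ ψ) →
    (∀ i → L (explPrem (R i)) (explConc (R i))) →
    L Γ φ

-- The explosive rule is Π ⊢ p, where p is fresh and Π consists of the formulas
-- G i ∨ G j (i < j) with G i = (qᵢ ∧ ∼qᵢ) ∨ (rᵢ ∧ ∼rᵢ).  Call a family of DM4
-- valuations blocking if no substitution instance of Π holds throughout it; the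
-- consequence relation "φ holds throughout every blocking family satisfying Γ"
-- is a logic containing ETL and the rule, so it extends the explosive extension.
-- A finite part of Π mentions only the pairs i ≤ 2m, and it holds, with p = ⊥,
-- throughout a family of 2m + 1 valuations arranged in a cycle, consecutive ones
-- being related by a relation ⌣ that every operation preserves.  This family is
-- blocking: under a substitution making Π true, at each point all pairs but at
-- most one are glutted (one of their values is b); a pair glutted at two
-- consecutive points alternates between (b, n) and (n, b), impossible around an
-- odd cycle, so each of the 2m + 2 pairs 0, …, 2m + 1 is unglutted somewhere,
-- and by pigeonhole two of them are unglutted at the same point.

module Submission where

open import Defs
open import Data.Bool using (Bool; true; false; not; T; _xor_) renaming (_∧_ to _∧ᵇ_)
open import Data.Bool.Properties using (T-∧; T-≡; not-involutive; not-distribˡ-xor; not-¬)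
open import Data.Empty using (⊥; ⊥-elim)
open import Data.Fin using (Fin; toℕ; fromℕ<)
open import Data.Fin.Properties using (pigeonhole; ¬∀⟶∃¬; toℕ-fromℕ<)
open import Data.List.Membership.Propositional using (_∈_)
open import Data.List.Relation.Unary.All using (All; []; _∷_)
open import Data.List.Relation.Unary.Any using (here; there)
open import Data.Nat using (ℕ; zero; suc; _+_; _<_; _≤_; _⊔_; _<ᵇ_; ⌊_/2⌋; z≤n; s≤s)
open import Data.Nat.Properties
  using (_≟_; _<?_; +-suc; ≤-refl; ≤-trans; n≤1+n; n<1+n; <⇒≤; <⇒≢; <⇒≱; ≮⇒≥; ≤∧≢⇒<;
         <⇒<ᵇ; m≤m⊔n; m≤n⊔m; m≤m+n)
open import Data.Product using (Σ-syntax; ∃; ∃₂; _×_; _,_; proj₁; proj₂)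
open import Data.Sum using (_⊎_; inj₁; inj₂)
import Data.Sum as Sum
open import Data.Unit using (⊤; tt)
open import Function using (_∘_)
open import Function.Bundles using (Equivalence)
open import Level using () renaming (zero to lzero)
open import Relation.Binary.Core using (_Preserves_⟶_; _Preserves₂_⟶_⟶_)
open import Relation.Binary.PropositionalEquality
  using (_≡_; _≢_; refl; sym; trans; cong; cong₂; module ≡-Reasoning)
  renaming (subst to subst≡)
open import Relation.Nullary using (¬_; yes; no)
open import Relation.Nullary.Decidable using (T?)

open ≡-Reasoning

-- x ⌣ y iff x ⊑ σ y, where ⊑ is the knowledge order (n least, b greatest) and
-- σ is the automorphism swapping n and b; as ⊓, ⊔ and ∼ are ⊑-monotone and
-- commute with σ, ⌣ is a subalgebra of DM4².
_⌣ᵇ_ : DM4 → DM4 → Bool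
n₄ ⌣ᵇ _  = true
_  ⌣ᵇ n₄ = true
⊥₄ ⌣ᵇ ⊥₄ = true
⊤₄ ⌣ᵇ ⊤₄ = true
_  ⌣ᵇ _  = false

_⌣_ : DM4 → DM4 → Set
x ⌣ y = T (x ⌣ᵇ y)

b-⌣ : ∀ {x} → b₄ ⌣ x → x ≡ n₄
b-⌣ {n₄} _ = refl

⌣-b : ∀ {x} → x ⌣ b₄ → x ≡ n₄
⌣-b {n₄} _ = refl

⌣-n : ∀ x → x ⌣ n₄
⌣-n ⊥₄ = tt
⌣-n n₄ = tt
⌣-n b₄ = tt
⌣-n ⊤₄ = tt

every : (DM4 → Bool) → Bool
every P = P ⊥₄ ∧ᵇ P n₄ ∧ᵇ P b₄ ∧ᵇ P ⊤₄

∧-split : ∀ x {y} → T (x ∧ᵇ y) → T x × T y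
∧-split x = Equivalence.to (T-∧ {x})

every-sound : ∀ (P : DM4 → Bool) → T (every P) → ∀ x → T (P x)
every-sound P h = at
  where
  rest₁ : T (P n₄ ∧ᵇ P b₄ ∧ᵇ P ⊤₄)
  rest₁ = proj₂ (∧-split (P ⊥₄) h)
  rest₂ : T (P b₄ ∧ᵇ P ⊤₄)
  rest₂ = proj₂ (∧-split (P n₄) rest₁)
  at : ∀ x → T (P x)
  at ⊥₄ = proj₁ (∧-split (P ⊥₄) h)
  at n₄ = proj₁ (∧-split (P n₄) rest₁)
  at b₄ = proj₁ (∧-split (P b₄) rest₂)
  at ⊤₄ = proj₂ (∧-split (P b₄) rest₂)

infixr 4 _⇒_

_⇒_ : Bool → Bool → Bool
true  ⇒ y = y
false ⇒ _ = true

⇒-elim : ∀ {x y} → T (x ⇒ y) → T x → T y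
⇒-elim {true} h _ = h

every²-sound : ∀ (R : DM4 → DM4 → Bool) →
  T (every λ x → every λ y → R x y) → ∀ x y → T (R x y)
every²-sound R h x = every-sound (R x) (every-sound (λ x → every (R x)) h x)

every⁴-sound : ∀ (R : DM4 → DM4 → DM4 → DM4 → Bool) →
  T (every λ x → every λ x' → every λ y → every λ y' → R x x' y y') →
  ∀ x x' y y' → T (R x x' y y')
every⁴-sound R h x x' = every²-sound (R x x') (every²-sound R₂ h x x')
  where
  R₂ : DM4 → DM4 → Bool
  R₂ x x' = every λ y → every λ y' → R x x' y y'

preserves-by-evaluation : ∀ (f : DM4 → DM4) →
  T (every λ x → every λ x' → x ⌣ᵇ x' ⇒ f x ⌣ᵇ f x') → f Preserves _⌣_ ⟶ _⌣_
preserves-by-evaluation f h {x} {x'} =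
  ⇒-elim (every²-sound (λ x x' → x ⌣ᵇ x' ⇒ f x ⌣ᵇ f x') h x x')

preserves₂-by-evaluation : ∀ (_∙_ : DM4 → DM4 → DM4) →
  T (every λ x → every λ x' → every λ y → every λ y' →
       x ⌣ᵇ x' ⇒ y ⌣ᵇ y' ⇒ (x ∙ y) ⌣ᵇ (x' ∙ y')) →
  _∙_ Preserves₂ _⌣_ ⟶ _⌣_ ⟶ _⌣_
preserves₂-by-evaluation _∙_ h {x} {x'} {y} {y'} x⌣x' y⌣y' =
  ⇒-elim (⇒-elim (every⁴-sound R h x x' y y') x⌣x') y⌣y'
  where
  R : DM4 → DM4 → DM4 → DM4 → Bool
  R x x' y y' = x ⌣ᵇ x' ⇒ y ⌣ᵇ y' ⇒ (x ∙ y) ⌣ᵇ (x' ∙ y')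

neg-⌣ : neg₄ Preserves _⌣_ ⟶ _⌣_
neg-⌣ = preserves-by-evaluation neg₄ tt

⊓-⌣ : _⊓_ Preserves₂ _⌣_ ⟶ _⌣_ ⟶ _⌣_
⊓-⌣ = preserves₂-by-evaluation _⊓_ tt

⊔-⌣ : _⊔₄_ Preserves₂ _⌣_ ⟶ _⌣_ ⟶ _⌣_
⊔-⌣ = preserves₂-by-evaluation _⊔₄_ tt

_⌣ᵛ_ : (ℕ → DM4) → (ℕ → DM4) → Set
v ⌣ᵛ v' = ∀ n → v n ⌣ v' n

eval-⌣ : ∀ {v v'} → v ⌣ᵛ v' → ∀ φ → eval v φ ⌣ eval v' φ
eval-⌣ h (var n) = h n
eval-⌣ h (φ ∧ ψ) = ⊓-⌣ (eval-⌣ h φ) (eval-⌣ h ψ)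
eval-⌣ h (φ ∨ ψ) = ⊔-⌣ (eval-⌣ h φ) (eval-⌣ h ψ)
eval-⌣ h (∼ φ)   = neg-⌣ (eval-⌣ h φ)
eval-⌣ h ⊤f      = tt
eval-⌣ h ⊥f      = tt

designated : DM4 → Bool
designated b₄ = true
designated ⊤₄ = true
designated _  = false

designated-⊤ : ∀ {x} → x ≡ ⊤₄ → T (designated x)
designated-⊤ refl = tt

designated-⊔ : ∀ x y → T (designated (x ⊔₄ y)) → T (designated x) ⊎ T (designated y)
designated-⊔ ⊤₄ _  _ = inj₁ tt
designated-⊔ b₄ _  _ = inj₁ tt
designated-⊔ ⊥₄ _  d = inj₂ d
designated-⊔ n₄ b₄ _ = inj₂ tt
designated-⊔ n₄ ⊤₄ _ = inj₂ tt

glut : DM4 → DM4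
glut x = x ⊓ neg₄ x

designated-glut : ∀ x → T (designated (glut x)) → x ≡ b₄
designated-glut b₄ _ = refl

designated-glut-⊔ : ∀ x y → T (designated (glut x ⊔₄ glut y)) → x ≡ b₄ ⊎ y ≡ b₄
designated-glut-⊔ x y d =
  Sum.map (designated-glut x) (designated-glut y) (designated-⊔ (glut x) (glut y) d)

isB : DM4 → Bool
isB b₄ = true
isB _  = false

glut-alternates : ∀ {x y x' y'} →
  T (designated (glut x ⊔₄ glut y)) → T (designated (glut x' ⊔₄ glut y')) →
  x ⌣ x' → y ⌣ y' → isB x' ≡ not (isB x)
glut-alternates {x} {y} {x'} {y'} d d' x⌣x' y⌣y'
  with designated-glut-⊔ x y d | designated-glut-⊔ x' y' d'
... | inj₁ refl | inj₁ refl = ⊥-elim x⌣x'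
... | inj₁ refl | inj₂ refl rewrite b-⌣ x⌣x' = refl
... | inj₂ refl | inj₁ refl rewrite ⌣-b x⌣x' = refl
... | inj₂ refl | inj₂ refl = ⊥-elim y⌣y'

subst-var : ∀ φ → subst var φ ≡ φ
subst-var (var n) = refl
subst-var (φ ∧ ψ) = cong₂ _∧_ (subst-var φ) (subst-var ψ)
subst-var (φ ∨ ψ) = cong₂ _∨_ (subst-var φ) (subst-var ψ)
subst-var (∼ φ)   = cong ∼_ (subst-var φ)
subst-var ⊤f      = refl
subst-var ⊥f      = refl

subst-subst : ∀ s s' φ → subst s (subst s' φ) ≡ subst (subst s ∘ s') φ
subst-subst s s' (var n) = refl
subst-subst s s' (φ ∧ ψ) = cong₂ _∧_ (subst-subst s s' φ) (subst-subst s s' ψ)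
subst-subst s s' (φ ∨ ψ) = cong₂ _∨_ (subst-subst s s' φ) (subst-subst s s' ψ)
subst-subst s s' (∼ φ)   = cong ∼_ (subst-subst s s' φ)
subst-subst s s' ⊤f      = refl
subst-subst s s' ⊥f      = refl

eval-subst : ∀ v s φ → eval v (subst s φ) ≡ eval (λ n → eval v (s n)) φ
eval-subst v s (var n) = refl
eval-subst v s (φ ∧ ψ) = cong₂ _⊓_ (eval-subst v s φ) (eval-subst v s ψ)
eval-subst v s (φ ∨ ψ) = cong₂ _⊔₄_ (eval-subst v s φ) (eval-subst v s ψ)
eval-subst v s (∼ φ)   = cong neg₄ (eval-subst v s φ)
eval-subst v s ⊤f      = refl
eval-subst v s ⊥f      = refl

Family : Set
Family = ℕ → ℕ → DM4

infix 4 _⊨_ _⊨ˢ_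
infixl 30 _⟨_⟩

_⊨_ : Family → Fm → Set
W ⊨ φ = ∀ t → eval (W t) φ ≡ ⊤₄

_⊨ˢ_ : Family → FmSet → Set
W ⊨ˢ Γ = ∀ ψ → Γ ψ → W ⊨ ψ

Blocks : FmSet → Family → Set
Blocks Π W = ∀ s → ¬ W ⊨ˢ (s [ Π ])

FamilyLogic : FmSet → RuleSet lzero
FamilyLogic Π Γ φ = ∀ W → Blocks Π W → W ⊨ˢ Γ → W ⊨ φ

_⟨_⟩ : Family → (ℕ → Fm) → Family
(W ⟨ s ⟩) t n = eval (W t) (s n)

FamilyLogic-substitution : ∀ Π Γ φ s → FamilyLogic Π Γ φ → FamilyLogic Π (s [ Γ ]) (subst s φ)
FamilyLogic-substitution Π Γ φ s Γ⊢φ W blocks sat t =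
  trans (eval-subst (W t) s φ) (Γ⊢φ (W ⟨ s ⟩) blocks-s sat-s t)
  where
  sat-s : W ⟨ s ⟩ ⊨ˢ Γ
  sat-s ψ Γψ u = trans (sym (eval-subst (W u) s ψ)) (sat (subst s ψ) (ψ , Γψ , refl) u)

  blocks-s : Blocks Π (W ⟨ s ⟩)
  blocks-s s' sat' = blocks (subst s ∘ s') λ where
    _ (χ , Πχ , refl) u → begin
      eval (W u) (subst (subst s ∘ s') χ)  ≡⟨ cong (eval (W u)) (sym (subst-subst s s' χ)) ⟩
      eval (W u) (subst s (subst s' χ))    ≡⟨ eval-subst (W u) s (subst s' χ) ⟩
      eval ((W ⟨ s ⟩) u) (subst s' χ)      ≡⟨ sat' _ (χ , Πχ , refl) u ⟩
      ⊤₄                                   ∎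

FamilyLogic-isLogic : ∀ Π → IsLogic (FamilyLogic Π)
FamilyLogic-isLogic Π = record
  { reflexivity  = λ Γ φ Γφ W _ sat → sat φ Γφ
  ; monotonicity = λ Γ Δ φ Γ⊆Δ Γ⊢φ W blocks sat → Γ⊢φ W blocks (λ ψ → sat ψ ∘ Γ⊆Δ ψ)
  ; cut          = λ Γ Δ φ Γ⊢Δ ΓΔ⊢φ W blocks sat → ΓΔ⊢φ W blocks λ where
                     ψ (inj₁ Γψ) → sat ψ Γψ
                     ψ (inj₂ Δψ) → Γ⊢Δ ψ Δψ W blocks sat
  ; substitution = FamilyLogic-substitution Π
  }

ETL⊆FamilyLogic : ∀ Π Γ φ → ETL Γ φ → FamilyLogic Π Γ φ
ETL⊆FamilyLogic Π Γ φ valid W _ sat t = valid (W t) (λ ψ Γψ → sat ψ Γψ t)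

FamilyLogic-explodes : ∀ Π s φ → FamilyLogic Π (s [ Π ]) φ
FamilyLogic-explodes Π s φ W blocks sat = ⊥-elim (blocks s sat)

explosiveRule : (Π : FmSet) (p : ℕ) → (∀ ψ → Π ψ → ¬ Occurs p ψ) → Explosive
explosiveRule Π p avoid = record
  { prem   = Π
  ; σ      = λ n → n
  ; σ-inj  = λ eq → eq
  ; p      = p
  ; avoids = λ ψ Πψ occurs → avoid ψ Πψ (subst≡ (Occurs p) (subst-var ψ) occurs)
  }

explosiveRule-derives : ∀ Π p avoid →
  ExplExt (λ (_ : ⊤) → explosiveRule Π p avoid) Π (var p)
explosiveRule-derives Π p avoid L isLogic _ rule =
  IsLogic.monotonicity isLogic _ Π (var p) renamed-premises (rule tt)
  where
  renamed-premises : explPrem (explosiveRule Π p avoid) ⊆ Π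
  renamed-premises ψ (χ , Πχ , ψ≡χ) = subst≡ Π (sym (trans ψ≡χ (subst-var χ))) Πχ

explosiveRule-not-finitary : ∀ Π p avoid →
  (∀ xs → All Π xs → Σ[ W ∈ Family ] Blocks Π W × W ⊨ˢ ⟦ xs ⟧ × ¬ W ⊨ var p) →
  ¬ Finitary (ExplExt (λ (_ : ⊤) → explosiveRule Π p avoid))
explosiveRule-not-finitary Π p avoid counter finitary
  with finitary Π (var p) (explosiveRule-derives Π p avoid)
... | xs , premises , derivation with counter xs premises
...   | W , blocks , sat , ¬p =
  ¬p (derivation (FamilyLogic Π) (FamilyLogic-isLogic Π) (ETL⊆FamilyLogic Π)
                 (λ _ → FamilyLogic-explodes Π var (var p)) W blocks sat)

even : ℕ → Bool
even zero    = true
even (suc n) = not (even n)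

alternating-double : ∀ (c : ℕ → Bool) {n} → (∀ t → t < n → c (suc t) ≡ not (c t)) →
  ∀ k → k + k ≤ n → c (k + k) ≡ c 0
alternating-double c alt zero    _  = refl
alternating-double c {n} alt (suc k) le = begin
  c (suc (k + suc k))   ≡⟨ cong (c ∘ suc) (+-suc k k) ⟩
  c (suc (suc (k + k))) ≡⟨ alt (suc (k + k)) le₂ ⟩
  not (c (suc (k + k))) ≡⟨ cong not (alt (k + k) le₁) ⟩
  not (not (c (k + k))) ≡⟨ not-involutive _ ⟩
  c (k + k)             ≡⟨ alternating-double c alt k (≤-trans (n≤1+n _) le₁) ⟩
  c 0                   ∎
  where
  le₂ : suc (suc (k + k)) ≤ n
  le₂ = subst≡ (_≤ n) (cong suc (+-suc k k)) le
  le₁ : suc (k + k) ≤ n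
  le₁ = ≤-trans (n≤1+n _) le₂

even-double : ∀ k → even (k + k) ≡ true
even-double k = alternating-double even (λ _ _ → refl) k ≤-refl

q r : ℕ → ℕ
q i = suc (i + i)
r i = suc (suc (i + i))

glutPair : ℕ → Fm
glutPair i = (var (q i) ∧ (∼ var (q i))) ∨ (var (r i) ∧ (∼ var (r i)))

Premise : FmSet
Premise ψ = ∃₂ λ i j → i < j × ψ ≡ glutPair i ∨ glutPair j

glutPair-avoids-0 : ∀ i → ¬ Occurs 0 (glutPair i)
glutPair-avoids-0 i (∨ˡ (∧ˡ ()))
glutPair-avoids-0 i (∨ˡ (∧ʳ (∼∙ ())))
glutPair-avoids-0 i (∨ʳ (∧ˡ ()))
glutPair-avoids-0 i (∨ʳ (∧ʳ (∼∙ ())))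

premise-avoids-0 : ∀ ψ → Premise ψ → ¬ Occurs 0 ψ
premise-avoids-0 _ (i , j , _ , refl) (∨ˡ occurs) = glutPair-avoids-0 i occurs
premise-avoids-0 _ (i , j , _ , refl) (∨ʳ occurs) = glutPair-avoids-0 j occurs

data PairState : Set where
  bad   : PairState
  split : Bool → PairState

values : PairState → DM4 × DM4
values bad           = n₄ , n₄
values (split true)  = b₄ , n₄
values (split false) = n₄ , b₄

_⌣²_ : DM4 × DM4 → DM4 × DM4 → Set
u ⌣² u' = proj₁ u ⌣ proj₁ u' × proj₂ u ⌣ proj₂ u'

⌣-bad : ∀ u → u ⌣² values bad
⌣-bad u = ⌣-n (proj₁ u) , ⌣-n (proj₂ u)

split-⌣ : ∀ {c c'} → c' ≡ not c → values (split c) ⌣² values (split c')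
split-⌣ {true}  refl = tt , tt
split-⌣ {false} refl = tt , tt

glutValue : DM4 × DM4 → DM4
glutValue u = glut (proj₁ u) ⊔₄ glut (proj₂ u)

split-glut : ∀ c → glutValue (values (split c)) ≡ ⊤₄
split-glut true  = refl
split-glut false = refl

colour : ℕ → ℕ → Bool
colour i t = even t xor (i <ᵇ t)

<ᵇ-suc : ∀ i t → t ≢ i → (i <ᵇ suc t) ≡ (i <ᵇ t)
<ᵇ-suc zero    zero    t≢i = ⊥-elim (t≢i refl)
<ᵇ-suc zero    (suc t) _   = refl
<ᵇ-suc (suc i) zero    _   = refl
<ᵇ-suc (suc i) (suc t) t≢i = <ᵇ-suc i t (t≢i ∘ cong suc)

colour-step : ∀ {i t} → t ≢ i → colour i (suc t) ≡ not (colour i t)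
colour-step {i} {t} t≢i = begin
  not (even t) xor (i <ᵇ suc t) ≡⟨ cong (not (even t) xor_) (<ᵇ-suc i t t≢i) ⟩
  not (even t) xor (i <ᵇ t)     ≡⟨ sym (not-distribˡ-xor (even t) (i <ᵇ t)) ⟩
  not (colour i t)              ∎

colour-wrap : ∀ {m i} → i < m + m → colour i 0 ≡ not (colour i (m + m))
colour-wrap {m} {i} i<2m
  rewrite even-double m | Equivalence.to T-≡ (<⇒<ᵇ i<2m) = refl

-- On the cycle 0, …, 2m, a pair i ≤ 2m is bad at t = i and alternates along the
-- remaining path i + 1, …, 2m, 0, …, i - 1; the pairs i > 2m are bad throughout.
pairState : ℕ → ℕ → ℕ → PairState
pairState m i t with m + m <? i | t ≟ i
... | no _ | no _ = split (colour i t)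
... | _    | _    = bad

pairState-split : ∀ {m i t} → i ≤ m + m → t ≢ i → pairState m i t ≡ split (colour i t)
pairState-split {m} {i} {t} i≤2m t≢i with m + m <? i | t ≟ i
... | yes 2m<i | _       = ⊥-elim (<⇒≱ 2m<i i≤2m)
... | no _     | yes t≡i = ⊥-elim (t≢i t≡i)
... | no _     | no _    = refl

pairState-step : ∀ m i t → values (pairState m i t) ⌣² values (pairState m i (suc t))
pairState-step m i t with m + m <? i | t ≟ i | suc t ≟ i
... | yes _ | _      | _     = tt , tt
... | no _  | yes _  | _     = tt , tt
... | no _  | no _   | yes _ = ⌣-bad _
... | no _  | no t≢i | no _  = split-⌣ (colour-step t≢i)

pairState-wrap : ∀ m i → values (pairState m i (m + m)) ⌣² values (pairState m i 0)
pairState-wrap m i with m + m <? i | m + m ≟ i | 0 ≟ i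
... | yes _   | _        | _     = tt , tt
... | no _    | yes _    | _     = tt , tt
... | no _    | no _     | yes _ = ⌣-bad _
... | no 2m≮i | no 2m≢i  | no _  =
  split-⌣ (colour-wrap {m} {i} (≤∧≢⇒< (≮⇒≥ 2m≮i) (2m≢i ∘ sym)))

select : Bool → DM4 × DM4 → DM4
select true  = proj₁
select false = proj₂

family : ℕ → Family
family m t zero    = ⊥₄
family m t (suc k) = select (even k) (values (pairState m ⌊ k /2⌋ t))

half-double : ∀ i → ⌊ i + i /2⌋ ≡ i
half-double zero = refl
half-double (suc i) rewrite +-suc i i = cong suc (half-double i)

half-suc-double : ∀ i → ⌊ suc (i + i) /2⌋ ≡ i
half-suc-double zero = refl
half-suc-double (suc i) rewrite +-suc i i = cong suc (half-suc-double i)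

family-q : ∀ m t i → family m t (q i) ≡ proj₁ (values (pairState m i t))
family-q m t i rewrite even-double i | half-double i = refl

family-r : ∀ m t i → family m t (r i) ≡ proj₂ (values (pairState m i t))
family-r m t i rewrite even-double i | half-suc-double i = refl

family-⌣ : ∀ {m t t'} → (∀ i → values (pairState m i t) ⌣² values (pairState m i t')) →
  family m t ⌣ᵛ family m t'
family-⌣ h zero    = tt
family-⌣ h (suc k) with even k | h ⌊ k /2⌋
... | true  | x⌣x' , _ = x⌣x'
... | false | _ , y⌣y' = y⌣y'

family-step : ∀ m t → family m t ⌣ᵛ family m (suc t)
family-step m t = family-⌣ (λ i → pairState-step m i t)

family-wrap : ∀ m → family m (m + m) ⌣ᵛ family m 0
family-wrap m = family-⌣ (pairState-wrap m)

family-refutes-0 : ∀ {m} → ¬ family m ⊨ var 0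
family-refutes-0 holds with holds 0
... | ()

family-glutPair : ∀ {m i t} → i ≤ m + m → t ≢ i → eval (family m t) (glutPair i) ≡ ⊤₄
family-glutPair {m} {i} {t} i≤2m t≢i = begin
  glut (family m t (q i)) ⊔₄ glut (family m t (r i))
    ≡⟨ cong₂ (λ x y → glut x ⊔₄ glut y) (family-q m t i) (family-r m t i) ⟩
  glutValue (values (pairState m i t))
    ≡⟨ cong (glutValue ∘ values) (pairState-split i≤2m t≢i) ⟩
  glutValue (values (split (colour i t)))
    ≡⟨ split-glut (colour i t) ⟩
  ⊤₄ ∎

⊔-⊤ʳ : ∀ x → x ⊔₄ ⊤₄ ≡ ⊤₄
⊔-⊤ʳ ⊥₄ = refl
⊔-⊤ʳ n₄ = refl
⊔-⊤ʳ b₄ = refl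
⊔-⊤ʳ ⊤₄ = refl

-- At most one pair is bad at a given point, so one disjunct of each premise is ⊤.
family-⊨-premise : ∀ {m i j} → i < j → j ≤ m + m → family m ⊨ (glutPair i ∨ glutPair j)
family-⊨-premise {m} {i} {j} i<j j≤2m t with t ≟ i
... | no t≢i   = cong (_⊔₄ eval (family m t) (glutPair j))
                       (family-glutPair {m} (≤-trans (<⇒≤ i<j) j≤2m) t≢i)
... | yes refl = trans (cong (eval (family m t) (glutPair i) ⊔₄_)
                             (family-glutPair {m} j≤2m (<⇒≢ i<j)))
                       (⊔-⊤ʳ _)

bound : ∀ {xs} → All Premise xs → ℕ
bound []                = 0
bound ((_ , j , _) ∷ ps) = j ⊔ bound ps

premise-bounded : ∀ {xs ψ} (ps : All Premise xs) → ψ ∈ xs →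
  ∃₂ λ i j → i < j × j ≤ bound ps × ψ ≡ glutPair i ∨ glutPair j
premise-bounded ((i , j , i<j , eq) ∷ _) (here refl) = i , j , i<j , m≤m⊔n j _ , eq
premise-bounded ((_ , j , _) ∷ ps) (there ψ∈xs) with premise-bounded ps ψ∈xs
... | i' , j' , i'<j' , j'≤ , eq = i' , j' , i'<j' , ≤-trans j'≤ (m≤n⊔m j (bound ps)) , eq

family-satisfies : ∀ {xs} (ps : All Premise xs) → family (bound ps) ⊨ˢ ⟦ xs ⟧
family-satisfies ps ψ ψ∈xs with premise-bounded ps ψ∈xs
... | i , j , i<j , j≤ , refl = family-⊨-premise i<j (≤-trans j≤ (m≤m+n _ _))

module _ (m : ℕ) (s : ℕ → Fm) (sat : family m ⊨ˢ (s [ Premise ])) where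

  private
    Glutted : ℕ → ℕ → Set
    Glutted i t = T (designated (eval (family m t) (subst s (glutPair i))))

    premise-glutted : ∀ {i j} → i < j → ∀ t → Glutted i t ⊎ Glutted j t
    premise-glutted {i} {j} i<j t = designated-⊔ _ _ (designated-⊤
      (sat _ (glutPair i ∨ glutPair j , (i , j , i<j , refl) , refl) t))

    colourAt : ℕ → ℕ → Bool
    colourAt i t = isB (eval (family m t) (s (q i)))

    glutted-alternates : ∀ {i t t'} → family m t ⌣ᵛ family m t' →
      Glutted i t → Glutted i t' → colourAt i t' ≡ not (colourAt i t)
    glutted-alternates {i} h g g' =
      glut-alternates g g' (eval-⌣ h (s (q i))) (eval-⌣ h (s (r i)))

    not-always-glutted : ∀ i → ¬ (∀ t → t ≤ m + m → Glutted i t)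
    not-always-glutted i glutted = not-¬ (sym around) wrap
      where
      around : colourAt i (m + m) ≡ colourAt i 0
      around = alternating-double (colourAt i)
        (λ t t<2m → glutted-alternates {i} (family-step m t)
                      (glutted t (<⇒≤ t<2m)) (glutted (suc t) t<2m))
        m ≤-refl
      wrap : colourAt i 0 ≡ not (colourAt i (m + m))
      wrap = glutted-alternates {i} (family-wrap m) (glutted (m + m) ≤-refl) (glutted 0 z≤n)

    unglutted-point : ∀ i → ∃ λ (t : Fin (suc (m + m))) → ¬ Glutted i (toℕ t)
    unglutted-point i = ¬∀⟶∃¬ _ _ (λ _ → T? _) λ glutted →
      not-always-glutted i λ t t≤2m →
        subst≡ (Glutted i) (toℕ-fromℕ< (s≤s t≤2m)) (glutted (fromℕ< (s≤s t≤2m)))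

  family-blocked : ⊥
  family-blocked with pigeonhole (n<1+n _) (proj₁ ∘ unglutted-point ∘ toℕ)
  ... | i , j , i<j , same with premise-glutted i<j (toℕ (proj₁ (unglutted-point (toℕ i))))
  ...   | inj₁ glutted-i = proj₂ (unglutted-point (toℕ i)) glutted-i
  ...   | inj₂ glutted-j =
    proj₂ (unglutted-point (toℕ j)) (subst≡ (Glutted (toℕ j) ∘ toℕ) same glutted-j)

family-blocks : ∀ m → Blocks Premise (family m)
family-blocks = family-blocked

proposition10p10 : Σ[ I ∈ Set ] Σ[ R ∈ (I → Explosive) ] ¬ Finitary (ExplExt R)
proposition10p10 =
  ⊤ , (λ _ → explosiveRule Premise 0 premise-avoids-0) ,
  explosiveRule-not-finitary Premise 0 premise-avoids-0 λ _ ps →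
    family (bound ps) , family-blocks (bound ps) , family-satisfies ps ,
    family-refutes-0 {bound ps}
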